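{- Let $TCS$ be the total constant specification for $\mathcal{GJ}45_0$. For every $\phi\in\mathcal{L}_J$ such that $\not\vdash_{\mathcal{GJ}45_{TCS}}\neg\neg\phi$ and all $t,s\in Jt$, \[ \not\vdash_{\mathcal{GJ}45_{TCS}}\neg\neg t:\phi\rightarrow s:\neg\neg\phi. \]
   Context: Justification terms $Jt$ are generated by $t::= c\mid x\mid [t+t]\mid [t\cdot t]\mid\, !t\mid\, ?t$, where $c$ ranges over constants $C=\{c_i\mid i\in\mathbb{N}\}$ and $x$ over variables $V=\{x_i\}$. The language $\mathcal{L}_J$ is $\phi::=\bot\mid p\mid(\phi\rightarrow\phi)\mid(\phi\land\phi)\mid t:\phi$ with $p\in Var=\{p_i\mid i\in\mathbb{N}\}$; $\neg\phi:=\phi\rightarrow\bot$. The calculus $\mathcal{GJ}45_0$ over $\mathcal{L}_J$ has the axiom schemes (A1) $(\phi\rightarrow\psi)\rightarrow((\psi\rightarrow\chi)\rightarrow(\phi\rightarrow\chi))$; (A2) $(\phi\land\psi)\rightarrow\phi$; (A3) $(\phi\land\psi)\rightarrow(\psi\land\phi)$; (A5a) $(\phi\rightarrow(\psi\rightarrow\chi))\rightarrow((\phi\land\psi)\rightarrow\chi)$; (A5b) $((\phi\land\psi)\rightarrow\chi)\rightarrow(\phi\rightarrow(\psi\rightarrow\chi))$; (A6) $((\phi\rightarrow\psi)\rightarrow\chi)\rightarrow(((\psi\rightarrow\phi)\rightarrow\chi)\rightarrow\chi)$; (A7) $\bot\rightarrow\phi$; (G4) $\phi\rightarrow(\phi\land\phi)$;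 (J) $t:(\phi\rightarrow\psi)\rightarrow(s:\phi\rightarrow[t\cdot s]:\psi)$; (+) $t:\phi\rightarrow[t+s]:\phi$ and $s:\phi\rightarrow[t+s]:\phi$; (!) $t:\phi\rightarrow\, !t:t:\phi$; (?) $\neg t:\phi\rightarrow\, ?t:\neg t:\phi$; and the rule (MP): from $\phi\rightarrow\psi$ and $\phi$ infer $\psi$. The total constant specification $TCS$ for $\mathcal{GJ}45_0$ is the set of all formulas $c_{i_n}:\dots:c_{i_1}:\phi$ with $n\ge1$, $i_1,\dots,i_n\in\mathbb{N}$ and $\phi$ an axiom instance of $\mathcal{GJ}45_0$. $\mathcal{GJ}45_{TCS}$ is $\mathcal{GJ}45_0$ plus the rule: from $c:\phi\in TCS$ infer $c:\phi$; $\vdash$ denotes provability. -}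

module Defs where

open import Data.Nat using (ℕ; suc)
open import Relation.Nullary using (¬_)

data Tm : Set where
  con  : ℕ → Tm
  var  : ℕ → Tm
  _⊕_  : Tm → Tm → Tm
  _⊙_  : Tm → Tm → Tm
  !_   : Tm → Tm
  ¿_   : Tm → Tm

infixr 5 _⇒_
infixr 6 _∧_
infixr 7 _∶_
data Fm : Set where
  ⊥'   : Fm
  prop : ℕ → Fm
  _⇒_  : Fm → Fm → Fm
  _∧_  : Fm → Fm → Fm
  _∶_  : Tm → Fm → Fm

~_ : Fm → Fm
~ φ = φ ⇒ ⊥'

data Axiom : Fm → Set where
  A1  : ∀ φ ψ χ → Axiom ((φ ⇒ ψ) ⇒ ((ψ ⇒ χ) ⇒ (φ ⇒ χ)))
  A2  : ∀ φ ψ → Axiom ((φ ∧ ψ) ⇒ φ)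
  A3  : ∀ φ ψ → Axiom ((φ ∧ ψ) ⇒ (ψ ∧ φ))
  A5a : ∀ φ ψ χ → Axiom ((φ ⇒ (ψ ⇒ χ)) ⇒ ((φ ∧ ψ) ⇒ χ))
  A5b : ∀ φ ψ χ → Axiom (((φ ∧ ψ) ⇒ χ) ⇒ (φ ⇒ (ψ ⇒ χ)))
  A6  : ∀ φ ψ χ → Axiom (((φ ⇒ ψ) ⇒ χ) ⇒ (((ψ ⇒ φ) ⇒ χ) ⇒ χ))
  A7  : ∀ φ → Axiom (⊥' ⇒ φ)
  G4  : ∀ φ → Axiom (φ ⇒ (φ ∧ φ))
  AJ  : ∀ t s φ ψ → Axiom ((t ∶ (φ ⇒ ψ)) ⇒ ((s ∶ φ) ⇒ ((t ⊙ s) ∶ ψ)))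
  A+l : ∀ t s φ → Axiom ((t ∶ φ) ⇒ ((t ⊕ s) ∶ φ))
  A+r : ∀ t s φ → Axiom ((s ∶ φ) ⇒ ((t ⊕ s) ∶ φ))
  A!  : ∀ t φ → Axiom ((t ∶ φ) ⇒ ((! t) ∶ (t ∶ φ)))
  A?  : ∀ t φ → Axiom ((~ (t ∶ φ)) ⇒ ((¿ t) ∶ (~ (t ∶ φ))))

data TCS : Fm → Set where
  base : ∀ i {φ} → Axiom φ → TCS (con i ∶ φ)
  step : ∀ i {φ} → TCS φ → TCS (con i ∶ φ)

data ⊢_ : Fm → Set where
  ax  : ∀ {φ} → Axiom φ → ⊢ φ
  mp  : ∀ {φ ψ} → ⊢ (φ ⇒ ψ) → ⊢ φ → ⊢ ψ
  cs  : ∀ {φ} → TCS φ → ⊢ φ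

-- Interpret formulas in the Lindenbaum algebra of GJ45_TCS with a fresh least element
-- adjoined below it: ⊥ goes to the new bottom, and t ∶ φ goes to φ ∧ t ∶ φ, which is
-- never the new bottom.  Every theorem is interpreted by a provable formula.  Below the
-- new bottom every old element is nonzero, so its double negation is the top ⊥' ⇒ ⊥';
-- hence ~ ~ (t ∶ φ) ⇒ s ∶ ~ ~ φ is interpreted as ⊤ ⇒ (~ ~ φ ∧ s ∶ ~ ~ φ), and its
-- provability would give ⊢ ~ ~ φ.
module Submission where

open import Defs
open import Relation.Nullary using (¬_)
open import Data.Maybe using (Maybe; just; nothing)
open import Data.Empty using (⊥)

⊤' : Fm
⊤' = ⊥' ⇒ ⊥'

⊢⊤ : ⊢ ⊤'
⊢⊤ = ax (A7 ⊥')

⇒-trans : ∀ {a b c} → ⊢ (a ⇒ b) → ⊢ (b ⇒ c) → ⊢ (a ⇒ c)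
⇒-trans {a} {b} {c} f g = mp (mp (ax (A1 a b c)) f) g

⇒-curry : ∀ {a b c} → ⊢ ((a ∧ b) ⇒ c) → ⊢ (a ⇒ (b ⇒ c))
⇒-curry {a} {b} {c} f = mp (ax (A5b a b c)) f

⇒-uncurry : ∀ {a b c} → ⊢ (a ⇒ (b ⇒ c)) → ⊢ ((a ∧ b) ⇒ c)
⇒-uncurry {a} {b} {c} f = mp (ax (A5a a b c)) f

K : ∀ a b → ⊢ (b ⇒ (a ⇒ b))
K a b = ⇒-curry (ax (A2 b a))

⇒-weaken : ∀ {a b} → ⊢ b → ⊢ (a ⇒ b)
⇒-weaken {a} {b} = mp (K a b)

⇒-refl : ∀ a → ⊢ (a ⇒ a)
⇒-refl a = ⇒-trans (ax (G4 a)) (ax (A2 a a))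

∧-fst : ∀ {a b} → ⊢ ((a ∧ b) ⇒ a)
∧-fst {a} {b} = ax (A2 a b)

∧-snd : ∀ {a b} → ⊢ ((a ∧ b) ⇒ b)
∧-snd {a} {b} = ⇒-trans (ax (A3 a b)) ∧-fst

∧-intro : ∀ a b → ⊢ (a ⇒ (b ⇒ (a ∧ b)))
∧-intro a b = ⇒-curry (⇒-refl (a ∧ b))

∧-pair : ∀ {a b} → ⊢ a → ⊢ b → ⊢ (a ∧ b)
∧-pair {a} {b} x y = mp (mp (∧-intro a b) x) y

⇒-swap : ∀ {a b c} → ⊢ (a ⇒ (b ⇒ c)) → ⊢ (b ⇒ (a ⇒ c))
⇒-swap {a} {b} f = ⇒-curry (⇒-trans (ax (A3 b a)) (⇒-uncurry f))

⇒-∧ : ∀ {z a b} → ⊢ (z ⇒ a) → ⊢ (z ⇒ b) → ⊢ (z ⇒ (a ∧ b))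
⇒-∧ {z} {a} {b} f g =
  ⇒-trans (ax (G4 z))
    (⇒-trans (⇒-uncurry (⇒-trans g (∧-intro b z)))
      (⇒-trans (ax (A3 b z)) (⇒-uncurry (⇒-trans f (∧-intro a b)))))

∧-map : ∀ {a b a′ b′} → ⊢ (a ⇒ b) → ⊢ (a′ ⇒ b′) → ⊢ ((a ∧ a′) ⇒ (b ∧ b′))
∧-map f g = ⇒-∧ (⇒-trans ∧-fst f) (⇒-trans ∧-snd g)

∧-interchange : ∀ a b c d → ⊢ (((a ∧ b) ∧ (c ∧ d)) ⇒ ((a ∧ c) ∧ (b ∧ d)))
∧-interchange a b c d = ⇒-∧ (∧-map ∧-fst ∧-fst) (∧-map ∧-snd ∧-snd)

∧-zipWith : ∀ {a b c a′ b′ c′} → ⊢ (a ⇒ (b ⇒ c)) → ⊢ (a′ ⇒ (b′ ⇒ c′)) →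
            ⊢ ((a ∧ a′) ⇒ ((b ∧ b′) ⇒ (c ∧ c′)))
∧-zipWith {a} {b} {c} {a′} {b′} f g =
  ⇒-curry (⇒-trans (∧-interchange a a′ b b′) (∧-map (⇒-uncurry f) (⇒-uncurry g)))

⊤⇒-elim : ∀ c → ⊢ ((⊤' ⇒ c) ⇒ c)
⊤⇒-elim c = mp (⇒-swap (⇒-refl (⊤' ⇒ c))) ⊢⊤

-- Truth values: nothing is the adjoined bottom, just a is the class of a.
Val : Set
Val = Maybe Fm

Designated : Val → Set
Designated nothing  = ⊥
Designated (just a) = ⊢ a

infixr 5 _⇛_
infixr 6 _⋏_

_⇛_ : Val → Val → Val
nothing ⇛ y      = just ⊤'
just a ⇛ nothing = nothing
just a ⇛ just b  = just (a ⇒ b)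

_⋏_ : Val → Val → Val
nothing ⋏ y      = nothing
just a ⋏ nothing = nothing
just a ⋏ just b  = just (a ∧ b)

⟦_⟧ : Fm → Val
⟦ ⊥' ⟧    = nothing
⟦ prop n ⟧ = just (prop n)
⟦ a ⇒ b ⟧ = ⟦ a ⟧ ⇛ ⟦ b ⟧
⟦ a ∧ b ⟧ = ⟦ a ⟧ ⋏ ⟦ b ⟧
⟦ t ∶ a ⟧ = just (a ∧ (t ∶ a))

⇛-weaken : ∀ x y → Designated y → Designated (x ⇛ y)
⇛-weaken nothing  y        _ = ⊢⊤
⇛-weaken (just a) (just b) g = ⇒-weaken g

⇛-mp : ∀ x y → Designated (x ⇛ y) → Designated x → Designated y
⇛-mp (just a) (just b) f g = mp f g

A1-sound : ∀ x y z → Designated ((x ⇛ y) ⇛ (y ⇛ z) ⇛ (x ⇛ z))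
A1-sound nothing  y        z        = ⇛-weaken _ _ (⇛-weaken (y ⇛ z) (nothing ⇛ z) ⊢⊤)
A1-sound (just a) nothing  z        = ⊢⊤
A1-sound (just a) (just b) nothing  = ⇛-weaken (just (a ⇒ b)) (just ⊤') ⊢⊤
A1-sound (just a) (just b) (just c) = ax (A1 a b c)

A2-sound : ∀ x y → Designated ((x ⋏ y) ⇛ x)
A2-sound nothing  y        = ⊢⊤
A2-sound (just a) nothing  = ⊢⊤
A2-sound (just a) (just b) = ax (A2 a b)

A3-sound : ∀ x y → Designated ((x ⋏ y) ⇛ (y ⋏ x))
A3-sound nothing  y        = ⊢⊤
A3-sound (just a) nothing  = ⊢⊤
A3-sound (just a) (just b) = ax (A3 a b)

A5a-sound : ∀ x y z → Designated ((x ⇛ y ⇛ z) ⇛ ((x ⋏ y) ⇛ z))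
A5a-sound nothing  y        z        = ⇛-weaken (nothing ⇛ y ⇛ z) (nothing ⇛ z) ⊢⊤
A5a-sound (just a) nothing  z        = ⇛-weaken (just a ⇛ nothing ⇛ z) (nothing ⇛ z) ⊢⊤
A5a-sound (just a) (just b) nothing  = ⊢⊤
A5a-sound (just a) (just b) (just c) = ax (A5a a b c)

A5b-sound : ∀ x y z → Designated (((x ⋏ y) ⇛ z) ⇛ (x ⇛ y ⇛ z))
A5b-sound nothing  y        z        = ⇛-weaken ((nothing ⋏ y) ⇛ z) (nothing ⇛ y ⇛ z) ⊢⊤
A5b-sound (just a) nothing  z        =
  ⇛-weaken ((just a ⋏ nothing) ⇛ z) (just a ⇛ nothing ⇛ z) (⇒-weaken ⊢⊤)
A5b-sound (just a) (just b) nothing  = ⊢⊤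
A5b-sound (just a) (just b) (just c) = ax (A5b a b c)

A6-sound : ∀ x y z → Designated (((x ⇛ y) ⇛ z) ⇛ ((y ⇛ x) ⇛ z) ⇛ z)
A6-sound nothing  nothing  nothing  = ⊢⊤
A6-sound nothing  nothing  (just c) = ⇒-trans (⊤⇒-elim c) (K (⊤' ⇒ c) c)
A6-sound nothing  (just b) nothing  = ⊢⊤
A6-sound nothing  (just b) (just c) = ⇒-refl (⊤' ⇒ c)
A6-sound (just a) nothing  nothing  = ⇒-weaken ⊢⊤
A6-sound (just a) nothing  (just c) = ⇒-weaken (⊤⇒-elim c)
A6-sound (just a) (just b) nothing  = ⊢⊤
A6-sound (just a) (just b) (just c) = ax (A6 a b c)

G4-sound : ∀ x → Designated (x ⇛ (x ⋏ x))
G4-sound nothing  = ⊢⊤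
G4-sound (just a) = ax (G4 a)

axiom-sound : ∀ {χ} → Axiom χ → Designated ⟦ χ ⟧
axiom-sound (A1 φ ψ χ)   = A1-sound ⟦ φ ⟧ ⟦ ψ ⟧ ⟦ χ ⟧
axiom-sound (A2 φ ψ)     = A2-sound ⟦ φ ⟧ ⟦ ψ ⟧
axiom-sound (A3 φ ψ)     = A3-sound ⟦ φ ⟧ ⟦ ψ ⟧
axiom-sound (A5a φ ψ χ)  = A5a-sound ⟦ φ ⟧ ⟦ ψ ⟧ ⟦ χ ⟧
axiom-sound (A5b φ ψ χ)  = A5b-sound ⟦ φ ⟧ ⟦ ψ ⟧ ⟦ χ ⟧
axiom-sound (A6 φ ψ χ)   = A6-sound ⟦ φ ⟧ ⟦ ψ ⟧ ⟦ χ ⟧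
axiom-sound (A7 φ)       = ⊢⊤
axiom-sound (G4 φ)       = G4-sound ⟦ φ ⟧
axiom-sound (AJ t s φ ψ) = ∧-zipWith (⇒-refl (φ ⇒ ψ)) (ax (AJ t s φ ψ))
axiom-sound (A+l t s φ)  = ∧-map (⇒-refl φ) (ax (A+l t s φ))
axiom-sound (A+r t s φ)  = ∧-map (⇒-refl φ) (ax (A+r t s φ))
axiom-sound (A! t φ)     = ⇒-∧ ∧-snd (⇒-trans ∧-snd (ax (A! t φ)))
axiom-sound (A? t φ)     = ⊢⊤

TCS-sound : ∀ {χ} → TCS χ → Designated ⟦ χ ⟧
TCS-sound (base i a) = ∧-pair (ax a) (cs (base i a))
TCS-sound (step i c) = ∧-pair (cs c) (cs (step i c))

sound : ∀ {χ} → ⊢ χ → Designated ⟦ χ ⟧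
sound (ax a)           = axiom-sound a
sound (mp {φ} {ψ} d e) = ⇛-mp ⟦ φ ⟧ ⟦ ψ ⟧ (sound d) (sound e)
sound (cs c)           = TCS-sound c

mainTheorem3 : (φ : Fm) → ¬ (⊢ (~ (~ φ))) → (t s : Tm) →
    ¬ (⊢ ((~ (~ (t ∶ φ))) ⇒ (s ∶ (~ (~ φ)))))
mainTheorem3 φ ⊬~~φ t s d = ⊬~~φ (mp ∧-fst (mp ⊤⇒[~~φ∧s∶~~φ] ⊢⊤))
  where
  ⊤⇒[~~φ∧s∶~~φ] : ⊢ (⊤' ⇒ (~ (~ φ) ∧ s ∶ ~ (~ φ)))
  ⊤⇒[~~φ∧s∶~~φ] = sound d
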